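{- Let $G$ be a graph, let $S,R\subseteq V(G)$, and let $F$ be a nonempty rooted forest. Let $d$ be the number of connected components of $F$ and let $p:=\mathrm{pw}(G,S)$. Assume that $G$ does not contain any $(S,R)$-rooted model of $F$. Then there exist a set $X\subseteq V(G)$ with $|X|\leq(d-1)(p+1)$ and a connected component $T$ of $F$ such that $G-X$ does not contain any $(S,R)$-rooted model of $T$.
   Context: A model of $H$ in $G$ is a collection of pairwise disjoint sets $\{W_v\subseteq V(G)\mid v\in V(H)\}$ (branch sets), each inducing a connected subgraph, such that for every edge $vw$ of $H$ some vertex of $W_v$ is adjacent to some vertex of $W_w$. The model is $S$-rooted if every branch set contains a vertex of $S$. For a rooted forest $F$, a model is weakly $R$-rooted if the branch set of each root of $F$ contains a vertex of $R$, and $(S,R)$-rooted if it is both $S$-rooted and weakly $R$-rooted; $S,R$ may contain vertices outside the graph considered (e.g. for $G-X$). A path-decomposition of $(G,S)$ consists of an induced subgraph $H$ of $G$ with $S\subseteq V(H)$ and a path-decomposition $\mathcal D$ of $H$ such that for every connected component $C$ of $G-V(H)$ some bag of $\mathcal D$ contains $N_G(V(C))$; $\mathrm{pw}(G,S)$ is the minimum width (max bag size minus one) of such a decomposition. -}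

module Defs where

open import Data.Nat using (ℕ; suc; _≤_; _<_; _*_; _∸_)
open import Data.Fin using (Fin; toℕ)
open import Data.Fin.Subset using (Subset; _∈_; _∉_; ∣_∣)
open import Data.Vec using (tabulate)
open import Data.Bool using (Bool; T)
open import Data.Maybe using (Maybe; just; nothing; is-nothing)
open import Data.Product using (Σ; ∃; _×_; _,_)
open import Relation.Binary.PropositionalEquality using (_≡_; _≢_)
open import Relation.Nullary using (¬_)

record Graph : Set where
  field
    n      : ℕ
    adj    : Fin n → Fin n → Bool
    sym    : ∀ u v → adj u v ≡ adj v u
    irrefl : ∀ u → adj u u ≡ Bool.false
open Graph public

Adj : (G : Graph) → Fin (n G) → Fin (n G) → Set
Adj G u v = T (adj G u v)

data Reach (G : Graph) (W : Subset (n G)) : Fin (n G) → Fin (n G) → Set where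
  here : ∀ {u} → u ∈ W → Reach G W u u
  step : ∀ {u w v} → u ∈ W → Adj G u w → Reach G W w v → Reach G W u v

Connected : (G : Graph) → Subset (n G) → Set
Connected G W = (∃ λ u → u ∈ W) × (∀ u v → u ∈ W → v ∈ W → Reach G W u v)

-- Acyclicity is witnessed by a rank strictly decreasing towards the root.
-- The edges of the forest are exactly the pairs {v , parent v}.

record RootedForest : Set where
  field
    m        : ℕ
    parent   : Fin m → Maybe (Fin m)
    rank     : Fin m → ℕ
    rank-dec : ∀ u v → parent v ≡ just u → rank u < rank v
open RootedForest public

IsRoot : (F : RootedForest) → Fin (m F) → Set
IsRoot F v = parent F v ≡ nothing

-- number of connected components = number of roots
numComponents : RootedForest → ℕ
numComponents F = ∣ tabulate (λ v → is-nothing (parent F v)) ∣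

data Below (F : RootedForest) (r : Fin (m F)) : Fin (m F) → Set where
  self : Below F r r
  down : ∀ {u v} → parent F v ≡ just u → Below F r u → Below F r v

-- (S,R)-rooted models of the sub-forest of F induced by a vertex set C
-- (C closed under parents; used with C = everything, or C = a component),
-- in G - X.

record RootedModel (G : Graph) (S R X : Subset (n G))
                   (F : RootedForest) (C : Fin (m F) → Set) : Set where
  field
    W         : Fin (m F) → Subset (n G)
    avoidX    : ∀ v → C v → ∀ x → x ∈ W v → x ∉ X
    disjoint  : ∀ v w → C v → C w → v ≢ w → ∀ x → x ∈ W v → ¬ (x ∈ W w)
    connected : ∀ v → C v → Connected G (W v)
    edges     : ∀ v u → C v → parent F v ≡ just u →
                ∃ λ a → ∃ λ b → a ∈ W v × b ∈ W u × Adj G a b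
    S-rooted  : ∀ v → C v → ∃ λ s → s ∈ W v × s ∈ S
    R-rooted  : ∀ v → C v → IsRoot F v → ∃ λ r → r ∈ W v × r ∈ R

IsComponentOutside : (G : Graph) → Subset (n G) → Subset (n G) → Set
IsComponentOutside G U C =
  Connected G C × (∀ x → x ∈ C → x ∉ U) ×
  (∀ u w → u ∈ C → Adj G u w → w ∉ U → w ∈ C)

record PathDecomposition (G : Graph) (S : Subset (n G)) : Set where
  field
    U        : Subset (n G)                -- V(H), H = G[U]
    S⊆U      : ∀ x → x ∈ S → x ∈ U
    k        : ℕ
    bag      : Fin k → Subset (n G)
    bag⊆U    : ∀ i x → x ∈ bag i → x ∈ U
    vertices : ∀ x → x ∈ U → ∃ λ i → x ∈ bag i
    edgesC   : ∀ x y → x ∈ U → y ∈ U → Adj G x y → ∃ λ i → x ∈ bag i × y ∈ bag i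
    interval : ∀ x (i j l : Fin k) → toℕ i ≤ toℕ j → toℕ j ≤ toℕ l →
               x ∈ bag i → x ∈ bag l → x ∈ bag j
    compsNbr : ∀ C → IsComponentOutside G U C →
               ∃ λ i → ∀ w → w ∉ C → (∃ λ u → u ∈ C × Adj G u w) → w ∈ bag i
open PathDecomposition public

HasPDWidth≤ : (G : Graph) → Subset (n G) → ℕ → Set
HasPDWidth≤ G S p = Σ (PathDecomposition G S) λ D → ∀ i → ∣ bag D i ∣ ≤ suc p

IsPw : (G : Graph) → Subset (n G) → ℕ → Set
IsPw G S p = HasPDWidth≤ G S p × (∀ q → HasPDWidth≤ G S q → p ≤ q)

-- Fix a path-decomposition of (G , S) of width p with bags B₀, …, B_{k-1}, and let the core A_j
-- consist of B_j and of the vertices of G - B_j that reach an earlier bag, or no vertex of the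
-- decomposition at all, in G - B_j. Take the least j such that some component T of F has an
-- (S,R)-rooted model inside A_j. A model of the other components in G - A_j would combine with
-- it into a model of F, so by induction on d there are a component T′ and a set X′ with
-- |X′| ≤ (d-2)(p+1) such that G - A_j - X′ has no model of T′; put X = X′ ∪ B_j. A model of T′
-- in G - X is connected and misses B_j, hence it lies either entirely outside A_j, which X′
-- forbids, or entirely among the vertices reaching an earlier bag. By the interval property of
-- the decomposition those lie in A_{j-1}, contradicting the choice of j.

module Submission where

open import Defs hiding (sym)
open import Data.Bool using (true; false; T)
open import Data.Bool.Properties using (T?)
open import Data.Empty using (⊥-elim)
open import Data.Fin using (Fin; zero; suc; toℕ; fromℕ<; _≟_)
open import Data.Fin.Properties using (any?; all?; toℕ<n; toℕ-fromℕ<; toℕ-injective)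
open import Data.Fin.Subset using (Subset; ⊥; ∁; _∈_; _∉_; _⊆_; _-_; _∪_; _∩_; ∣_∣)
open import Data.Fin.Subset.Properties
  using ( _∈?_; anySubset?; ∣p∣≤n; ∣⊥∣≡0; ∣⁅x⁆∣≡1; p⊆q⇒∣p∣≤∣q∣; x∈p⇒∣p-x∣<∣p∣; x∈⁅y⁆⇒x≡y
        ; p─q⊆p; x∈p∧x≢y⇒x∈p-y; ∪-identityˡ; p⊆p∪q; q⊆p∪q; x∈p∪q⁻; x∈p∩q⁺; x∈p∩q⁻
        ; x∈∁p⇒x∉p; x∉p⇒x∈∁p )
open import Data.Maybe using (just; nothing; is-nothing)
open import Data.Maybe.Properties using (just-injective; ≡-dec)
open import Data.Nat as ℕ using (ℕ; zero; suc; _+_; _*_; _∸_; _≤_; _<_; z≤n; s≤s)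
open import Data.Nat.Properties
  using ( module ≤-Reasoning; ≤-refl; ≤-reflexive; ≤-trans; <-≤-trans; ≤-<-trans; ≤-pred
        ; <⇒≱; <-irrefl; <-cmp; n≤1+n; m≤n⇒m<n∨m≡n; m≤n+m∸n; +-suc; +-comm; +-mono-≤; +-monoʳ-≤ )
open import Data.Product using (Σ; ∃; _×_; _,_; proj₁; proj₂)
open import Data.Sum as Sum using (_⊎_; inj₁; inj₂)
open import Data.Unit using (⊤; tt)
open import Data.Vec using ([]; _∷_; there; tabulate)
open import Data.Vec.Functional using (head; tail) renaming (_∷_ to _∷ᶠ_)
open import Data.Vec.Properties using ([]=⇒lookup; lookup⇒[]=; lookup∘tabulate)
open import Function using (id; _∘_; case_of_)
open import Relation.Binary using (tri<; tri≈; tri>)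
open import Relation.Binary.PropositionalEquality
  using (_≡_; _≢_; refl; sym; trans; cong; subst; subst₂)
open import Relation.Nullary using (¬_; Dec; yes; no; does; map′; ¬?; _×-dec_; _⊎-dec_; _→-dec_)
open import Relation.Nullary.Decidable using (dec-true)
open import Relation.Unary using (Decidable)

toSubset : ∀ {n} {P : Fin n → Set} → Decidable P → Subset n
toSubset P? = tabulate (does ∘ P?)

module _ {n} {P : Fin n → Set} (P? : Decidable P) {x : Fin n} where

  ∈-toSubset⁺ : P x → x ∈ toSubset P?
  ∈-toSubset⁺ px = lookup⇒[]= x _ (trans (lookup∘tabulate _ x) (dec-true (P? x) px))

  ∈-toSubset⁻ : x ∈ toSubset P? → P x
  ∈-toSubset⁻ x∈ with P? x | trans (sym (lookup∘tabulate _ x)) ([]=⇒lookup x∈)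
  ... | yes px | _ = px

x∈p-y⇒x≢y : ∀ {n} {p : Subset n} {x y : Fin n} → x ∈ p - y → x ≢ y
x∈p-y⇒x≢y {p = _ ∷ _} {zero} () refl
x∈p-y⇒x≢y {p = _ ∷ p} {suc x} (there x∈) refl = x∈p-y⇒x≢y {p = p} x∈ refl

∣p∪q∣≤∣p∣+∣q∣ : ∀ {n} (p q : Subset n) → ∣ p ∪ q ∣ ≤ ∣ p ∣ + ∣ q ∣
∣p∪q∣≤∣p∣+∣q∣ []          []          = z≤n
∣p∪q∣≤∣p∣+∣q∣ (true ∷ p)  (true ∷ q)  =
  s≤s (≤-trans (∣p∪q∣≤∣p∣+∣q∣ p q) (+-monoʳ-≤ ∣ p ∣ (n≤1+n _)))
∣p∪q∣≤∣p∣+∣q∣ (true ∷ p)  (false ∷ q) = s≤s (∣p∪q∣≤∣p∣+∣q∣ p q)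
∣p∪q∣≤∣p∣+∣q∣ (false ∷ p) (true ∷ q)  =
  ≤-trans (s≤s (∣p∪q∣≤∣p∣+∣q∣ p q)) (≤-reflexive (sym (+-suc ∣ p ∣ ∣ q ∣)))
∣p∪q∣≤∣p∣+∣q∣ (false ∷ p) (false ∷ q) = ∣p∪q∣≤∣p∣+∣q∣ p q

∣⊥∣≤ : ∀ n {k} → ∣ ⊥ {n} ∣ ≤ k
∣⊥∣≤ n = ≤-trans (≤-reflexive (∣⊥∣≡0 n)) z≤n

x∈p⇒0<∣p∣ : ∀ {n} {p : Subset n} {x} → x ∈ p → 0 < ∣ p ∣
x∈p⇒0<∣p∣ {p = p} {x} x∈p = ≤-trans (≤-reflexive (sym (∣⁅x⁆∣≡1 x)))
                                      (p⊆q⇒∣p∣≤∣q∣ λ y∈ → subst (_∈ p) (sym (x∈⁅y⁆⇒x≡y x y∈)) x∈p)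

module _ {B : Set} (anyB? : ∀ {Q : B → Set} → Decidable Q → Dec (∃ Q)) where

  anyFunction? : ∀ k {P : (Fin k → B) → Set} →
                 (∀ {f g} → (∀ i → f i ≡ g i) → P f → P g) → Decidable P → Dec (∃ P)
  anyFunction? zero P-cong P? with P? (λ ())
  ... | yes p = yes (_ , p)
  ... | no ¬p = no λ (f , pf) → ¬p (P-cong (λ ()) pf)
  anyFunction? (suc k) {P} P-cong P?
    with anyB? (λ b → anyFunction? k (λ e → P-cong λ { zero → refl ; (suc i) → e i }) (P? ∘ (b ∷ᶠ_)))
  ... | yes (b , f , p) = yes (b ∷ᶠ f , p)
  ... | no ∄ = no λ (f , pf) → ∄ (head f , tail f , P-cong (λ { zero → refl ; (suc i) → refl }) pf)

FailsBefore : (ℕ → Set) → ℕ → Set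
FailsBefore Q zero    = ⊤
FailsBefore Q (suc t) = ¬ Q t

boundary : ∀ {Q : ℕ → Set} → Decidable Q → ∀ {j} → Q j → ∃ λ i → Q i × FailsBefore Q i
boundary Q? {zero} q = zero , q , tt
boundary Q? {suc t} q with Q? t
... | yes q′ = boundary Q? q′
... | no ¬q  = suc t , q , ¬q

module Walks (G : Graph) where

  private
    V = Fin (n G)
    variable
      W W′ : Subset (n G)
      u v w : V

  Adj-sym : Adj G u v → Adj G v u
  Adj-sym {u} {v} = subst T (Graph.sym G u v)

  source∈ : Reach G W u v → u ∈ W
  source∈ (here u∈) = u∈
  source∈ (step u∈ _ _) = u∈

  target∈ : Reach G W u v → v ∈ W
  target∈ (here v∈) = v∈
  target∈ (step _ _ r) = target∈ r

  Reach-mono : W ⊆ W′ → Reach G W u v → Reach G W′ u v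
  Reach-mono W⊆ (here u∈) = here (W⊆ u∈)
  Reach-mono W⊆ (step u∈ a r) = step (W⊆ u∈) a (Reach-mono W⊆ r)

  Reach-trans : Reach G W u v → Reach G W v w → Reach G W u w
  Reach-trans (here _) r′ = r′
  Reach-trans (step u∈ a r) r′ = step u∈ a (Reach-trans r r′)

  Reach-snoc : Reach G W u v → Adj G v w → w ∈ W → Reach G W u w
  Reach-snoc r a w∈ = Reach-trans r (step (target∈ r) a (here w∈))

  Reach-sym : Reach G W u v → Reach G W v u
  Reach-sym (here u∈) = here u∈
  Reach-sym (step u∈ a r) = Reach-snoc (Reach-sym r) (Adj-sym a) u∈

  module _ {Q : V → Set} (closed : ∀ {x y} → Q x → x ∈ W → Adj G x y → y ∈ W → Q y) where

    Reach-preserves : Q u → Reach G W u v → Q v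
    Reach-preserves qu (here _) = qu
    Reach-preserves qu (step u∈ a r) = Reach-preserves (closed qu u∈ a (source∈ r)) r

    Reach-restrict : (∀ {x} → Q x → x ∈ W → x ∈ W′) → Q u → Reach G W u v → Reach G W′ u v
    Reach-restrict Q⊆ qu (here u∈) = here (Q⊆ qu u∈)
    Reach-restrict Q⊆ qu (step u∈ a r) =
      step (Q⊆ qu u∈) a (Reach-restrict Q⊆ (closed qu u∈ a (source∈ r)) r)

  first-entry : ∀ {U} → Reach G W w v → w ∉ U → v ∈ U →
                ∃ λ c → c ∈ U × c ∈ W × ∃ λ w′ → Reach G (∁ U) w w′ × Adj G w′ c
  first-entry (here _) w∉ v∈ = ⊥-elim (w∉ v∈)
  first-entry {U = U} (step {w} {w₁} _ a r) w∉ v∈ with w₁ ∈? U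
  ... | yes w₁∈ = w₁ , w₁∈ , source∈ r , w , here (x∉p⇒x∈∁p w∉) , a
  ... | no w₁∉ = let c , c∈U , c∈W , w′ , r′ , a′ = first-entry r w₁∉ v∈ in
                 c , c∈U , c∈W , w′ , step (x∉p⇒x∈∁p w∉) a r′ , a′

  lastVisit : Reach G W w v → v ≢ u →
              Reach G (W - u) w v ⊎ ∃ λ w′ → Adj G u w′ × Reach G (W - u) w′ v
  lastVisit (here v∈) v≢u = inj₁ (here (x∈p∧x≢y⇒x∈p-y v∈ v≢u))
  lastVisit {u = u} (step {x} {y} x∈ a r) v≢u with lastVisit r v≢u
  ... | inj₂ exit = inj₂ exit
  ... | inj₁ r′ with x ≟ u
  ...   | yes refl = inj₂ (y , a , r′)
  ...   | no x≢u = inj₁ (step (x∈p∧x≢y⇒x∈p-y x∈ x≢u) a r′)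

  private
    reach? : ∀ fuel W → ∣ W ∣ < fuel → ∀ u v → Dec (Reach G W u v)
    reach? (suc fuel) W (s≤s ∣W∣≤) u v with u ∈? W
    ... | no u∉ = no (u∉ ∘ source∈)
    ... | yes u∈ with u ≟ v
    ...   | yes refl = yes (here u∈)
    ...   | no u≢v with any? (λ w → T? (adj G u w) ×-dec
                         reach? fuel (W - u) (<-≤-trans (x∈p⇒∣p-x∣<∣p∣ u∈) ∣W∣≤) w v)
    ...     | yes (w , a , r) = yes (step u∈ a (Reach-mono (p─q⊆p W _) r))
    ...     | no ∄w = no λ r → case lastVisit r (u≢v ∘ sym) of λ
                        { (inj₁ r′) → x∈p-y⇒x≢y (source∈ r′) refl
                        ; (inj₂ exit) → ∄w exit }

  Reach? : ∀ W u v → Dec (Reach G W u v)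
  Reach? W = reach? (suc (n G)) W (s≤s (∣p∣≤n W))

  Connected? : ∀ W → Dec (Connected G W)
  Connected? W = any? (_∈? W) ×-dec
                 all? λ u → all? λ v → (u ∈? W) →-dec (v ∈? W) →-dec Reach? W u v

  componentOf : Subset (n G) → V → Subset (n G)
  componentOf U w = toSubset (Reach? (∁ U) w)

  ∈-componentOf⁺ : ∀ U {x} → Reach G (∁ U) w x → x ∈ componentOf U w
  ∈-componentOf⁺ {w} U = ∈-toSubset⁺ (Reach? (∁ U) w)

  ∈-componentOf⁻ : ∀ U {x} → x ∈ componentOf U w → Reach G (∁ U) w x
  ∈-componentOf⁻ {w} U = ∈-toSubset⁻ (Reach? (∁ U) w)

  componentOf-isComponent : ∀ {U} → w ∉ U → IsComponentOutside G U (componentOf U w)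
  componentOf-isComponent {w} {U} w∉ =
      ((w , ∈C⁺ (here (x∉p⇒x∈∁p w∉))) , λ a b a∈ b∈ →
         Reach-restrict (λ r _ a y∈ → Reach-snoc r a y∈) (λ r _ → ∈C⁺ r) (∈C⁻ a∈)
                        (Reach-trans (Reach-sym (∈C⁻ a∈)) (∈C⁻ b∈)))
    , (λ x x∈ → x∈∁p⇒x∉p (target∈ (∈C⁻ x∈)))
    , (λ u y u∈ a y∉ → ∈C⁺ (Reach-snoc (∈C⁻ u∈) a (x∉p⇒x∈∁p y∉)))
    where
    ∈C⁺ : ∀ {x} → Reach G (∁ U) w x → x ∈ componentOf U w
    ∈C⁺ = ∈-componentOf⁺ U
    ∈C⁻ : ∀ {x} → x ∈ componentOf U w → Reach G (∁ U) w x
    ∈C⁻ = ∈-componentOf⁻ U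

module Forest (F : RootedForest) where

  private
    variable
      r u v : Fin (m F)

    below? : ∀ fuel r v → rank F v < fuel → Dec (Below F r v)
    below? (suc fuel) r v (s≤s rank≤) with v ≟ r
    ... | yes refl = yes self
    ... | no v≢r with parent F v in eq
    ...   | nothing = no λ { self → v≢r refl ; (down e _) → case trans (sym e) eq of λ () }
    ...   | just u with below? fuel r u (<-≤-trans (rank-dec F u v eq) rank≤)
    ...     | yes b = yes (down eq b)
    ...     | no ¬b = no λ { self → v≢r refl
                           ; (down e b) → ¬b (subst (Below F r) (just-injective (trans (sym e) eq)) b) }

  Below? : ∀ r v → Dec (Below F r v)
  Below? r v = below? (suc (rank F v)) r v ≤-refl

  private
    rootAbove : ∀ fuel v → rank F v < fuel → ∃ λ r → IsRoot F r × Below F r v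
    rootAbove (suc fuel) v (s≤s rank≤) with parent F v in eq
    ... | nothing = v , eq , self
    ... | just u with rootAbove fuel u (<-≤-trans (rank-dec F u v eq) rank≤)
    ...   | r , root , b = r , root , down eq b

  below-root : ∀ v → ∃ λ r → IsRoot F r × Below F r v
  below-root v = rootAbove (suc (rank F v)) v ≤-refl

  roots : Subset (m F)
  roots = tabulate λ v → is-nothing (parent F v)

  ∈-roots⁺ : IsRoot F r → r ∈ roots
  ∈-roots⁺ {r} root = lookup⇒[]= r roots (trans (lookup∘tabulate _ r) (cong is-nothing root))

  ∈-roots⁻ : r ∈ roots → IsRoot F r
  ∈-roots⁻ {r} r∈ with parent F r | trans (sym (lookup∘tabulate _ r)) ([]=⇒lookup r∈)
  ... | nothing | _ = refl

  Below-parent : IsRoot F r → Below F r v → parent F v ≡ just u → Below F r u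
  Below-parent root self e with () ← trans (sym e) root
  Below-parent root (down e′ b) e with refl ← just-injective (trans (sym e′) e) = b

module Models (G : Graph) (S R : Subset (n G)) (F : RootedForest) where

  open Walks G

  private
    V = Fin (n G)
    variable
      X X′ : Subset (n G)
      C C′ : Fin (m F) → Set

  Model : Subset (n G) → (Fin (m F) → Set) → Set
  Model X C = RootedModel G S R X F C

  Inside : Model X C → (V → Set) → Set
  Inside {C = C} M P = ∀ v → C v → ∀ x → x ∈ RootedModel.W M v → P x

  restrict : Model X C → X′ ⊆ X → (∀ {v} → C′ v → C v) → Model X′ C′
  restrict M X′⊆X C′⊆C = record
    { W         = W
    ; avoidX    = λ v c x x∈ → avoidX v (C′⊆C c) x x∈ ∘ X′⊆X
    ; disjoint  = λ v w cv cw → disjoint v w (C′⊆C cv) (C′⊆C cw)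
    ; connected = λ v → connected v ∘ C′⊆C
    ; edges     = λ v u → edges v u ∘ C′⊆C
    ; S-rooted  = λ v → S-rooted v ∘ C′⊆C
    ; R-rooted  = λ v → R-rooted v ∘ C′⊆C
    }
    where open RootedModel M

  avoiding : (M : Model X C) → Inside M (_∉ X′) → Model X′ C
  avoiding M avoid = record
    { W = W ; avoidX = avoid ; disjoint = disjoint ; connected = connected
    ; edges = edges ; S-rooted = S-rooted ; R-rooted = R-rooted }
    where open RootedModel M

  emptyModel : (∀ {v} → ¬ C v) → Model X C
  emptyModel ∄ = record
    { W = λ _ → ⊥ ; avoidX = λ _ → ⊥-elim ∘ ∄ ; disjoint = λ _ _ → ⊥-elim ∘ ∄
    ; connected = λ _ → ⊥-elim ∘ ∄ ; edges = λ _ _ → ⊥-elim ∘ ∄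
    ; S-rooted = λ _ → ⊥-elim ∘ ∄ ; R-rooted = λ _ → ⊥-elim ∘ ∄ }

  -- The two models are disjoint since `cover` forbids every vertex to one of them.
  module _ {X₁ X₂ : Subset (n G)} {C₁ C₂ : Fin (m F) → Set} (C₁? : Decidable C₁)
           (C₁-up : ∀ {v u} → C₁ v → parent F v ≡ just u → C₁ u)
           (C₁-down : ∀ {v u} → parent F v ≡ just u → C₁ u → C₁ v)
           (C₂-up : ∀ {v u} → C₂ v → parent F v ≡ just u → C₂ u)
           (cover : ∀ x → x ∈ X₁ ⊎ x ∈ X₂)
           (M₁ : Model X₁ C₁) (M₂ : Model X₂ C₂) where

    private
      module M₁ = RootedModel M₁
      module M₂ = RootedModel M₂

      branch : ∀ v → Dec (C₁ v) → Subset (n G)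
      branch v (yes _) = M₁.W v
      branch v (no _)  = M₂.W v

      W : Fin (m F) → Subset (n G)
      W v = branch v (C₁? v)

      C₁∪C₂ : Fin (m F) → Set
      C₁∪C₂ v = C₁ v ⊎ C₂ v

      second : ∀ {v} → C₁∪C₂ v → ¬ C₁ v → C₂ v
      second (inj₁ c₁) ¬c₁ = ⊥-elim (¬c₁ c₁)
      second (inj₂ c₂) _   = c₂

      apart : ∀ {v w x} → C₁ v → C₂ w → x ∈ M₁.W v → x ∉ M₂.W w
      apart {v} {w} {x} c₁ c₂ x∈₁ x∈₂ with cover x
      ... | inj₁ x∈X₁ = M₁.avoidX v c₁ x x∈₁ x∈X₁
      ... | inj₂ x∈X₂ = M₂.avoidX w c₂ x x∈₂ x∈X₂

      avoidX : ∀ v → C₁∪C₂ v → ∀ x → x ∈ W v → x ∉ X₁ ∩ X₂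
      avoidX v c x x∈ x∈X with C₁? v
      ... | yes c₁ = M₁.avoidX v c₁ x x∈ (proj₁ (x∈p∩q⁻ X₁ X₂ x∈X))
      ... | no ¬c₁ = M₂.avoidX v (second c ¬c₁) x x∈ (proj₂ (x∈p∩q⁻ X₁ X₂ x∈X))

      disjoint : ∀ v w → C₁∪C₂ v → C₁∪C₂ w → v ≢ w → ∀ x → x ∈ W v → x ∉ W w
      disjoint v w cv cw v≢w x x∈v x∈w with C₁? v | C₁? w
      ... | yes c₁v | yes c₁w = M₁.disjoint v w c₁v c₁w v≢w x x∈v x∈w
      ... | yes c₁v | no ¬c₁w = apart c₁v (second cw ¬c₁w) x∈v x∈w
      ... | no ¬c₁v | yes c₁w = apart c₁w (second cv ¬c₁v) x∈w x∈v
      ... | no ¬c₁v | no ¬c₁w = M₂.disjoint v w (second cv ¬c₁v) (second cw ¬c₁w) v≢w x x∈v x∈w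

      connected : ∀ v → C₁∪C₂ v → Connected G (W v)
      connected v c with C₁? v
      ... | yes c₁ = M₁.connected v c₁
      ... | no ¬c₁ = M₂.connected v (second c ¬c₁)

      edges : ∀ v u → C₁∪C₂ v → parent F v ≡ just u → ∃ λ a → ∃ λ b → a ∈ W v × b ∈ W u × Adj G a b
      edges v u c e with C₁? v | C₁? u
      ... | yes c₁v | yes _    = M₁.edges v u c₁v e
      ... | yes c₁v | no ¬c₁u  = ⊥-elim (¬c₁u (C₁-up c₁v e))
      ... | no ¬c₁v | yes c₁u  = ⊥-elim (¬c₁v (C₁-down e c₁u))
      ... | no ¬c₁v | no _     = M₂.edges v u (second c ¬c₁v) e

      S-rooted : ∀ v → C₁∪C₂ v → ∃ λ s → s ∈ W v × s ∈ S
      S-rooted v c with C₁? v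
      ... | yes c₁ = M₁.S-rooted v c₁
      ... | no ¬c₁ = M₂.S-rooted v (second c ¬c₁)

      R-rooted : ∀ v → C₁∪C₂ v → IsRoot F v → ∃ λ r → r ∈ W v × r ∈ R
      R-rooted v c with C₁? v
      ... | yes c₁ = M₁.R-rooted v c₁
      ... | no ¬c₁ = M₂.R-rooted v (second c ¬c₁)

    glue : Model (X₁ ∩ X₂) (λ v → C₁ v ⊎ C₂ v)
    glue = record { W = W ; avoidX = avoidX ; disjoint = disjoint ; connected = connected
                  ; edges = edges ; S-rooted = S-rooted ; R-rooted = R-rooted }

  IsModel : Subset (n G) → (Fin (m F) → Set) → (Fin (m F) → Subset (n G)) → Set
  IsModel X C W =
      (∀ v → C v → ∀ x → x ∈ W v → x ∉ X)
    × (∀ v w → C v → C w → v ≢ w → ∀ x → x ∈ W v → x ∉ W w)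
    × (∀ v → C v → Connected G (W v))
    × (∀ v u → C v → parent F v ≡ just u → ∃ λ a → ∃ λ b → a ∈ W v × b ∈ W u × Adj G a b)
    × (∀ v → C v → ∃ λ s → s ∈ W v × s ∈ S)
    × (∀ v → C v → IsRoot F v → ∃ λ r → r ∈ W v × r ∈ R)

  IsModel? : ∀ X → Decidable C → Decidable (IsModel X C)
  IsModel? X C? W =
        all? (λ v → C? v →-dec all? λ x → (x ∈? W v) →-dec ¬? (x ∈? X))
    ×-dec all? (λ v → all? λ w → C? v →-dec C? w →-dec ¬? (v ≟ w) →-dec
                                 all? λ x → (x ∈? W v) →-dec ¬? (x ∈? W w))
    ×-dec all? (λ v → C? v →-dec Connected? (W v))
    ×-dec all? (λ v → all? λ u → C? v →-dec ≡-dec _≟_ (parent F v) (just u) →-dec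
                                 any? λ a → any? λ b → (a ∈? W v) ×-dec (b ∈? W u) ×-dec T? (adj G a b))
    ×-dec all? (λ v → C? v →-dec any? λ s → (s ∈? W v) ×-dec (s ∈? S))
    ×-dec all? (λ v → C? v →-dec ≡-dec _≟_ (parent F v) nothing →-dec any? λ r → (r ∈? W v) ×-dec (r ∈? R))

  IsModel-cong : ∀ {W W′} → (∀ v → W v ≡ W′ v) → IsModel X C W → IsModel X C W′
  IsModel-cong {W = W} {W′} W≗W′ (avoid , disj , conn , edge , S-root , R-root) =
      (λ v c x → avoid v c x ∘ from v)
    , (λ v w cv cw v≢w x x∈v x∈w → disj v w cv cw v≢w x (from v x∈v) (from w x∈w))
    , (λ v c → subst (Connected G) (W≗W′ v) (conn v c))
    , (λ v u c e → let a , b , a∈ , b∈ , ab = edge v u c e in a , b , to v a∈ , to u b∈ , ab)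
    , (λ v c → let s , s∈ , sS = S-root v c in s , to v s∈ , sS)
    , (λ v c root → let r , r∈ , rR = R-root v c root in r , to v r∈ , rR)
    where
    to : ∀ v {x} → x ∈ W v → x ∈ W′ v
    to v = subst (_ ∈_) (W≗W′ v)
    from : ∀ v {x} → x ∈ W′ v → x ∈ W v
    from v = subst (_ ∈_) (sym (W≗W′ v))

  Model? : ∀ X → Decidable C → Dec (Model X C)
  Model? X C? = map′ fromIsModel toIsModel
                     (anyFunction? anySubset? (m F) IsModel-cong (IsModel? X C?))
    where
    fromIsModel : ∃ (IsModel X _) → Model X _
    fromIsModel (W , avoidX , disjoint , connected , edges , S-rooted , R-rooted) = record
      { W = W ; avoidX = avoidX ; disjoint = disjoint ; connected = connected
      ; edges = edges ; S-rooted = S-rooted ; R-rooted = R-rooted }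
    toIsModel : Model X _ → ∃ (IsModel X _)
    toIsModel M = W , avoidX , disjoint , connected , edges , S-rooted , R-rooted
      where open RootedModel M

  ClosedOff : Subset (n G) → (V → Set) → Set
  ClosedOff Z P = ∀ {x y} → P x → y ∉ Z → Adj G x y → P y

  -- A model avoiding Z lies in one connected piece of G - Z.
  module _ {Z X : Subset (n G)} {P : V → Set} {b} (Z⊆X : Z ⊆ X) (closed : ClosedOff Z P)
           (M : Model X (Below F b)) where
    open RootedModel M

    private
      avoidsZ : ∀ {v x} → Below F b v → x ∈ W v → x ∉ Z
      avoidsZ c x∈ = avoidX _ c _ x∈ ∘ Z⊆X

      fill : ∀ {v x} → Below F b v → x ∈ W v → P x → ∀ y → y ∈ W v → P y
      fill c x∈ px y y∈ =
        Reach-preserves (λ px′ _ a y∈′ → closed px′ (avoidsZ c y∈′) a) px (proj₂ (connected _ c) _ y x∈ y∈)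

      descend : ∀ {v} → Below F b v → (∀ x → x ∈ W b → P x) → ∀ x → x ∈ W v → P x
      descend self allP = allP
      descend (down {u} e bu) allP with edges _ u (down e bu) e
      ... | a , a′ , a∈ , a′∈ , adj =
        fill (down e bu) a∈ (closed (descend bu allP a′ a′∈) (avoidsZ (down e bu) a∈) (Adj-sym adj))

    spread : ∀ {x} → x ∈ W b → P x → Inside M P
    spread x∈ px v c = descend c (fill self x∈ px)

  -- What the induction uses from a path-decomposition: `cut j` is the bag B_j, `Core j` the
  -- core A_j, and `Left j` the vertices reaching an earlier bag in G - B_j.
  record Sweep (p : ℕ) : Set₁ where
    field
      end       : ℕ
      cut       : ℕ → Subset (n G)
      Core      : ℕ → Subset (n G)
      Left      : ℕ → V → Set
      ∣cut∣≤    : ∀ j → ∣ cut j ∣ ≤ suc p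
      Left-zero : ∀ {x} → ¬ Left 0 x
      Left-suc  : ∀ {t x} → Left (suc t) x → x ∈ Core t
      one-side  : ∀ {X j b} → cut j ⊆ X → (M : Model X (Below F b)) →
                  Inside M (Left j) ⊎ Inside M (_∉ Core j)
      Core-end  : ∀ {X b} (M : Model X (Below F b)) → Inside M (_∈ Core end)

  Trees : Subset (m F) → Fin (m F) → Set
  Trees P v = ∃ λ r → r ∈ P × Below F r v

  Roots : Subset (m F) → Set
  Roots P = ∀ r → r ∈ P → IsRoot F r

  module Peeling {p} (sweep : Sweep p) where
    open Sweep sweep
    open Forest F using (Below?; Below-parent)

    private
      variable
        Y : Subset (n G)
        P : Subset (m F)
        a b : Fin (m F)
        j : ℕ

    FitsIn : Subset (n G) → Subset (m F) → ℕ → Set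
    FitsIn Y P j = ∃ λ a → a ∈ P × Model (Y ∪ ∁ (Core j)) (Below F a)

    FitsIn? : ∀ Y P → Decidable (FitsIn Y P)
    FitsIn? Y P j = any? λ a → (a ∈? P) ×-dec Model? (Y ∪ ∁ (Core j)) (Below? a)

    no-left-model : FailsBefore (FitsIn Y P) j → b ∈ P →
                    (M : Model Y (Below F b)) → ¬ Inside M (Left j)
    no-left-model {j = zero} _ _ M inLeft =
      let s , s∈ , _ = RootedModel.S-rooted M _ self in Left-zero (inLeft _ self s s∈)
    no-left-model {Y = Y} {j = suc t} ¬fits b∈P M inLeft = ¬fits (_ , b∈P , avoiding M inside)
      where
      inside : Inside M (_∉ Y ∪ ∁ (Core t))
      inside v c x x∈ x∈′ with x∈p∪q⁻ Y _ x∈′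
      ... | inj₁ x∈Y  = RootedModel.avoidX M v c x x∈ x∈Y
      ... | inj₂ x∈∁C = x∈∁p⇒x∉p x∈∁C (Left-suc (inLeft v c x x∈))

    across-cut : FailsBefore (FitsIn Y P) j → b ∈ P →
                 ¬ Model ((Y ∪ Core j) ∪ X′) (Below F b) → ¬ Model (Y ∪ X′ ∪ cut j) (Below F b)
    across-cut {Y = Y} {j = j} {X′ = X′} fails b∈P ¬M M with one-side (q⊆p∪q Y _ ∘ q⊆p∪q X′ _) M
    ... | inj₁ inLeft = no-left-model fails b∈P (restrict M (p⊆p∪q _) id) inLeft
    ... | inj₂ beyond = ¬M (avoiding M outside)
      where
      outside : Inside M (_∉ (Y ∪ Core j) ∪ X′)
      outside v c x x∈ x∈′ with x∈p∪q⁻ (Y ∪ Core j) X′ x∈′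
      ... | inj₂ x∈X′ = RootedModel.avoidX M v c x x∈ (q⊆p∪q Y _ (p⊆p∪q _ x∈X′))
      ... | inj₁ x∈YC with x∈p∪q⁻ Y (Core j) x∈YC
      ...   | inj₁ x∈Y = RootedModel.avoidX M v c x x∈ (p⊆p∪q _ x∈Y)
      ...   | inj₂ x∈C = beyond v c x x∈ x∈C

    Trees-up : Roots P → ∀ {v u} → Trees P v → parent F v ≡ just u → Trees P u
    Trees-up roots (r , r∈P , b) e = r , r∈P , Below-parent (roots r r∈P) b e

    glue-trees : Roots P → a ∈ P → Model (Y ∪ ∁ (Core j)) (Below F a) →
                 Model (Y ∪ Core j) (Trees (P - a)) → Model Y (Trees P)
    glue-trees {P = P} {a = a} {Y = Y} {j = j} roots a∈P Mₐ Mᵣ =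
      restrict (glue (Below? a) (Below-parent (roots a a∈P)) down
                     (Trees-up (λ r → roots r ∘ p─q⊆p P _)) cover Mₐ Mᵣ)
               (λ y∈ → x∈p∩q⁺ (p⊆p∪q _ y∈ , p⊆p∪q _ y∈)) split
      where
      cover : ∀ x → x ∈ Y ∪ ∁ (Core j) ⊎ x ∈ Y ∪ Core j
      cover x with x ∈? Core j
      ... | yes x∈C = inj₂ (q⊆p∪q Y _ x∈C)
      ... | no x∉C  = inj₁ (q⊆p∪q Y _ (x∉p⇒x∈∁p x∉C))
      split : ∀ {v} → Trees P v → Below F a v ⊎ Trees (P - a) v
      split (r , r∈P , b) with r ≟ a
      ... | yes refl = inj₁ b
      ... | no r≢a   = inj₂ (r , x∈p∧x≢y⇒x∈p-y r∈P r≢a , b)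

    ¬Model-∪⊥ : ¬ Model Y (Below F a) → ¬ Model (Y ∪ ⊥) (Below F a)
    ¬Model-∪⊥ ¬M M = ¬M (restrict M (p⊆p∪q ⊥) id)

    fits-at-end : a ∈ P → Model Y (Below F a) → FitsIn Y P end
    fits-at-end {Y = Y} a∈P M = _ , a∈P , avoiding M inside
      where
      inside : Inside M (_∉ Y ∪ ∁ (Core end))
      inside v c x x∈ x∈′ with x∈p∪q⁻ Y _ x∈′
      ... | inj₁ x∈Y  = RootedModel.avoidX M v c x x∈ x∈Y
      ... | inj₂ x∈∁C = x∈∁p⇒x∉p x∈∁C (Core-end M v c x x∈)

    one-tree : ∣ P ∣ ≤ 1 → a ∈ P → ∀ {v} → Trees P v → Below F a v
    one-tree {a = a} ∣P∣≤1 a∈P (r , r∈P , b) with r ≟ a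
    ... | yes refl = b
    ... | no r≢a   = ⊥-elim (<⇒≱ (<-≤-trans (x∈p⇒∣p-x∣<∣p∣ a∈P) ∣P∣≤1)
                                 (x∈p⇒0<∣p∣ (x∈p∧x≢y⇒x∈p-y r∈P r≢a)))

    ∣∪cut∣≤ : ∀ d {X} j → ∣ X ∣ ≤ d * suc p → ∣ X ∪ cut j ∣ ≤ suc d * suc p
    ∣∪cut∣≤ d {X} j ∣X∣≤ = begin
      ∣ X ∪ cut j ∣           ≤⟨ ∣p∪q∣≤∣p∣+∣q∣ X (cut j) ⟩
      ∣ X ∣ + ∣ cut j ∣       ≤⟨ +-mono-≤ ∣X∣≤ (∣cut∣≤ j) ⟩
      d * suc p + suc p       ≡⟨ +-comm (d * suc p) (suc p) ⟩
      suc d * suc p           ∎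
      where open ≤-Reasoning

    peel : ∀ d P Y → Roots P → ∣ P ∣ ≤ suc d → ¬ Model Y (Trees P) →
           Σ (Subset (n G)) λ X → ∣ X ∣ ≤ d * suc p × ∃ λ r → r ∈ P × ¬ Model (Y ∪ X) (Below F r)
    peel d P Y roots ∣P∣≤ ¬M with any? (_∈? P)
    ... | no ∄r = ⊥-elim (¬M (emptyModel λ (r , r∈P , _) → ∄r (r , r∈P)))
    peel zero P Y roots ∣P∣≤1 ¬M | yes (a , a∈P) =
      ⊥ , ∣⊥∣≤ (n G) , a , a∈P , ¬Model-∪⊥ λ M → ¬M (restrict M id (one-tree ∣P∣≤1 a∈P))
    peel (suc d) P Y roots ∣P∣≤ ¬M | yes (a₀ , a₀∈P) with FitsIn? Y P end
    ... | no ¬fits = ⊥ , ∣⊥∣≤ (n G) , a₀ , a₀∈P , ¬Model-∪⊥ (¬fits ∘ fits-at-end a₀∈P)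
    ... | yes fits with boundary (FitsIn? Y P) fits
    ...   | j , (a , a∈P , Mₐ) , fails
            with peel d (P - a) (Y ∪ Core j) (λ r → roots r ∘ p─q⊆p P _)
                      (≤-pred (≤-trans (x∈p⇒∣p-x∣<∣p∣ a∈P) ∣P∣≤)) (¬M ∘ glue-trees roots a∈P Mₐ)
    ...     | X′ , ∣X′∣≤ , b , b∈P-a , ¬Mb =
              X′ ∪ cut j , ∣∪cut∣≤ d {X′} j ∣X′∣≤ , b , b∈P , across-cut fails b∈P ¬Mb
      where b∈P = p─q⊆p P _ b∈P-a

module PathSweep (G : Graph) (S R : Subset (n G)) (F : RootedForest) (D : PathDecomposition G S) where

  open Walks G
  open Models G S R F

  private
    module D = PathDecomposition D
    V = Fin (n G)
    variable
      t j : ℕ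
      u v w x y z : V

  InBag : ℕ → V → Set
  InBag j x = ∃ λ i → toℕ i ≡ j × x ∈ D.bag i

  InBag? : ∀ j → Decidable (InBag j)
  InBag? j x = any? λ i → (toℕ i ℕ.≟ j) ×-dec (x ∈? D.bag i)

  -- The bag with index j, or ⊥ when j ≥ k.
  bagAt : ℕ → Subset (n G)
  bagAt j = toSubset (InBag? j)

  ∈-bagAt⁺ : ∀ i → toℕ i ≡ j → x ∈ D.bag i → x ∈ bagAt j
  ∈-bagAt⁺ {j} i i≡j x∈ = ∈-toSubset⁺ (InBag? j) (i , i≡j , x∈)

  ∈-bagAt⁻ : x ∈ bagAt j → InBag j x
  ∈-bagAt⁻ {j = j} = ∈-toSubset⁻ (InBag? j)

  bagAt⊆U : bagAt j ⊆ D.U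
  bagAt⊆U x∈ = let i , _ , x∈i = ∈-bagAt⁻ x∈ in D.bag⊆U i _ x∈i

  bagAt-end : x ∉ bagAt D.k
  bagAt-end x∈ = let i , i≡k , _ = ∈-bagAt⁻ x∈ in <-irrefl i≡k (toℕ<n i)

  bagAt-suc : x ∈ bagAt t → ∀ i → t < toℕ i → x ∈ D.bag i → x ∈ bagAt (suc t)
  bagAt-suc {x} {t} x∈t i t<i x∈i with ∈-bagAt⁻ x∈t
  ... | i₀ , i₀≡t , x∈i₀ = ∈-bagAt⁺ next toℕ-next (D.interval x i₀ next i i₀≤next next≤i x∈i₀ x∈i)
    where
    t+1<k = ≤-<-trans t<i (toℕ<n i)
    next = fromℕ< t+1<k
    toℕ-next : toℕ next ≡ suc t
    toℕ-next = toℕ-fromℕ< t+1<k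
    i₀≤next : toℕ i₀ ≤ toℕ next
    i₀≤next = subst₂ _≤_ (sym i₀≡t) (sym toℕ-next) (n≤1+n t)
    next≤i : toℕ next ≤ toℕ i
    next≤i = subst (_≤ toℕ i) (sym toℕ-next) t<i

  Off : ℕ → V → V → Set
  Off j = Reach G (∁ (bagAt j))

  InBagBefore : ℕ → V → Set
  InBagBefore j y = ∃ λ i → toℕ i < j × y ∈ D.bag i

  Left : ℕ → V → Set
  Left j x = ∃ λ y → InBagBefore j y × Off j x y

  Detached : ℕ → V → Set
  Detached j x = x ∉ bagAt j × ∀ u → u ∈ D.U → ¬ Off j x u

  Right : ℕ → V → Set
  Right j x = x ∉ bagAt j × ¬ Left j x × ¬ Detached j x

  Left? : ∀ j → Decidable (Left j)
  Left? j x = any? λ y → any? (λ i → (suc (toℕ i) ℕ.≤? j) ×-dec (y ∈? D.bag i)) ×-dec Reach? _ x y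

  Detached? : ∀ j → Decidable (Detached j)
  Detached? j x = ¬? (x ∈? bagAt j) ×-dec all? λ u → (u ∈? D.U) →-dec ¬? (Reach? _ x u)

  InCore : ℕ → V → Set
  InCore j x = x ∈ bagAt j ⊎ Left j x ⊎ Detached j x

  InCore? : ∀ j → Decidable (InCore j)
  InCore? j x = (x ∈? bagAt j) ⊎-dec Left? j x ⊎-dec Detached? j x

  Core : ℕ → Subset (n G)
  Core j = toSubset (InCore? j)

  Left-closed : ClosedOff (bagAt j) (Left j)
  Left-closed (y , before , off) y∉ a = y , before , step (x∉p⇒x∈∁p y∉) (Adj-sym a) off

  Detached-closed : ClosedOff (bagAt j) (Detached j)
  Detached-closed (x∉ , cut-off) y∉ a = y∉ , λ u u∈U off → cut-off u u∈U (step (x∉p⇒x∈∁p x∉) a off)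

  Right-closed : ClosedOff (bagAt j) (Right j)
  Right-closed (x∉ , ¬left , ¬detached) y∉ a =
    y∉ , (λ left → ¬left (Left-closed left x∉ (Adj-sym a)))
       , (λ detached → ¬detached (Detached-closed detached x∉ (Adj-sym a)))

  Right⇒∉Core : Right j x → x ∉ Core j
  Right⇒∉Core {j} (x∉ , ¬left , ¬detached) x∈ with ∈-toSubset⁻ (InCore? j) x∈
  ... | inj₁ x∈bag = x∉ x∈bag
  ... | inj₂ (inj₁ left) = ¬left left
  ... | inj₂ (inj₂ detached) = ¬detached detached

  first-contact : Off (suc t) x y → InBagBefore (suc t) y → x ∉ bagAt t →
                  Left t x ⊎ ∃ λ w → ∃ λ z → Off t x w × Adj G w z × z ∈ bagAt t × z ∉ bagAt (suc t)
  first-contact {x = x} (here _) (i , s≤s i≤t , x∈i) x∉ with m≤n⇒m<n∨m≡n i≤t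
  ... | inj₁ i<t = inj₁ (x , (i , i<t , x∈i) , here (x∉p⇒x∈∁p x∉))
  ... | inj₂ i≡t = ⊥-elim (x∉ (∈-bagAt⁺ i i≡t x∈i))
  first-contact {t} (step {x} {x′} _ a off) before x∉ with x′ ∈? bagAt t
  ... | yes x′∈ = inj₂ (x , x′ , here (x∉p⇒x∈∁p x∉) , a , x′∈ , x∈∁p⇒x∉p (source∈ off))
  ... | no x′∉ = Sum.map (λ left → Left-closed left x∉ (Adj-sym a))
                         (λ (w , z , off′ , rest) → w , z , step (x∉p⇒x∈∁p x∉) a off′ , rest)
                         (first-contact off before x′∉)

  -- z lies in bag t but not in bag t + 1, so by the interval property every bag containing
  -- z comes no later than t.
  Left-via-bag : z ∈ bagAt t → z ∉ bagAt (suc t) → Off t x v →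
                 ∀ i → v ∈ D.bag i → z ∈ D.bag i → Left t x
  Left-via-bag {t = t} z∈t z∉t+1 off i v∈i z∈i with <-cmp (toℕ i) t
  ... | tri< i<t _ _ = _ , (i , i<t , v∈i) , off
  ... | tri≈ _ i≡t _ = ⊥-elim (x∈∁p⇒x∉p (target∈ off) (∈-bagAt⁺ i i≡t v∈i))
  ... | tri> _ _ t<i = ⊥-elim (z∉t+1 (bagAt-suc z∈t i t<i z∈i))

  ∁U⊆∁bagAt : ∁ D.U ⊆ ∁ (bagAt j)
  ∁U⊆∁bagAt x∈ = x∉p⇒x∈∁p (x∈∁p⇒x∉p x∈ ∘ bagAt⊆U)

  Left-via-component : z ∈ bagAt t → z ∉ bagAt (suc t) → Off t x w → Adj G w z → w ∉ D.U →
                       Off t x u → u ∈ D.U → Left t x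
  Left-via-component {t = t} {w = w} z∈t z∉t+1 off-w a w∉U off-u u∈U
    with first-entry (Reach-trans (Reach-sym off-w) off-u) w∉U u∈U
  ... | c , c∈U , c∉t , w′ , w↝w′ , a′ =
    Left-via-bag z∈t z∉t+1 off-c iC (neighbour c∈U w↝w′ a′)
                                   (neighbour (bagAt⊆U z∈t) (here (x∉p⇒x∈∁p w∉U)) a)
    where
    off-c : Off t _ c
    off-c = Reach-snoc (Reach-trans off-w (Reach-mono ∁U⊆∁bagAt w↝w′)) a′ c∉t
    isComp = componentOf-isComponent w∉U
    iC = proj₁ (D.compsNbr _ isComp)
    neighbour : ∀ {y v} → y ∈ D.U → Reach G (∁ D.U) w v → Adj G v y → y ∈ D.bag iC
    neighbour y∈U w↝v a = proj₂ (D.compsNbr _ isComp) _ (λ y∈C → proj₁ (proj₂ isComp) _ y∈C y∈U)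
                                                    (_ , ∈-componentOf⁺ D.U w↝v , a)

  Left-suc⊆Core : Left (suc t) x → x ∈ Core t
  Left-suc⊆Core {t} {x} (y , before , off) = ∈-toSubset⁺ (InCore? t) inCore
    where
    inCore : InCore t x
    inCore with x ∈? bagAt t
    ... | yes x∈ = inj₁ x∈
    ... | no x∉ with first-contact off before x∉
    ...   | inj₁ left = inj₂ (inj₁ left)
    ...   | inj₂ (w , z , off-w , a , z∈t , z∉t+1) with w ∈? D.U
    ...     | yes w∈U = let i , w∈i , z∈i = D.edgesC w z w∈U (bagAt⊆U z∈t) a in
                        inj₂ (inj₁ (Left-via-bag z∈t z∉t+1 off-w i w∈i z∈i))
    ...     | no w∉U with any? (λ u → (u ∈? D.U) ×-dec Reach? _ x u)
    ...       | yes (u , u∈U , off-u) =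
                  inj₂ (inj₁ (Left-via-component z∈t z∉t+1 off-w a w∉U off-u u∈U))
    ...       | no ∄u = inj₂ (inj₂ (x∉ , λ u u∈U off-u → ∄u (u , u∈U , off-u)))

  one-side : ∀ {X j b} → bagAt j ⊆ X → (M : Model X (Below F b)) →
             Inside M (Left j) ⊎ Inside M (_∉ Core j)
  one-side {j = j} bag⊆X M with RootedModel.S-rooted M _ self
  ... | s , s∈ , s∈S with Left? j s
  ...   | yes left = inj₁ (spread bag⊆X Left-closed M s∈ left)
  ...   | no ¬left =
    inj₂ λ v c x x∈ → Right⇒∉Core (spread bag⊆X Right-closed M s∈ right v c x x∈)
    where
    s∉ : s ∉ bagAt j
    s∉ = RootedModel.avoidX M _ self s s∈ ∘ bag⊆X
    right : Right j s
    right = s∉ , ¬left , λ (_ , cut-off) → cut-off s (D.S⊆U s s∈S) (here (x∉p⇒x∈∁p s∉))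

  Core-end : ∀ {X b} (M : Model X (Below F b)) → Inside M (_∈ Core D.k)
  Core-end M v c x x∈ with RootedModel.S-rooted M v c
  ... | s , s∈ , s∈S with D.vertices s (D.S⊆U s s∈S)
  ...   | i , s∈i = ∈-toSubset⁺ (InCore? D.k) (inj₂ (inj₁ (s , (i , toℕ<n i , s∈i) , off)))
    where
    off : Off D.k x s
    off = Reach-mono (λ _ → x∉p⇒x∈∁p bagAt-end) (proj₂ (RootedModel.connected M v c) x s x∈ s∈)

  ∣bagAt∣≤ : ∀ {p} → (∀ i → ∣ D.bag i ∣ ≤ suc p) → ∀ j → ∣ bagAt j ∣ ≤ suc p
  ∣bagAt∣≤ width≤ j with any? (λ i → toℕ i ℕ.≟ j)
  ... | yes (i , i≡j) = ≤-trans (p⊆q⇒∣p∣≤∣q∣ bagAt⊆bag) (width≤ i)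
    where
    bagAt⊆bag : bagAt j ⊆ D.bag i
    bagAt⊆bag x∈ with ∈-bagAt⁻ x∈
    ... | i′ , i′≡j , x∈i′ = subst (λ i → _ ∈ D.bag i) (toℕ-injective (trans i′≡j (sym i≡j))) x∈i′
  ... | no ∄i = ≤-trans (p⊆q⇒∣p∣≤∣q∣ bagAt⊆⊥) (∣⊥∣≤ (n G))
    where
    bagAt⊆⊥ : bagAt j ⊆ ⊥
    bagAt⊆⊥ x∈ = let i , i≡j , _ = ∈-bagAt⁻ x∈ in ⊥-elim (∄i (i , i≡j))

  sweep : ∀ {p} → (∀ i → ∣ D.bag i ∣ ≤ suc p) → Sweep p
  sweep width≤ = record
    { end = D.k ; cut = bagAt ; Core = Core ; Left = Left
    ; ∣cut∣≤ = ∣bagAt∣≤ width≤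
    ; Left-zero = λ { (_ , (_ , () , _) , _) }
    ; Left-suc = Left-suc⊆Core
    ; one-side = one-side
    ; Core-end = Core-end
    }

lemma20 : (G : Graph) (S R : Subset (n G)) (F : RootedForest) → 0 < m F →
    (p : ℕ) → IsPw G S p →
    ¬ RootedModel G S R ⊥ F (λ _ → ⊤) →
    Σ (Subset (n G)) λ X → ∣ X ∣ ≤ (numComponents F ∸ 1) * suc p ×
    (∃ λ r → IsRoot F r × ¬ RootedModel G S R X F (Below F r))
-- An empty forest always has a model.
lemma20 G S R F _ p ((D , width≤) , _) ¬M =
  let X , ∣X∣≤ , r , r∈ , ¬Mr = peel (numComponents F ∸ 1) roots ⊥ (λ _ → ∈-roots⁻)
                                     (m≤n+m∸n (numComponents F) 1) (¬M ∘ everything)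
  in X , ∣X∣≤ , r , ∈-roots⁻ r∈ , subst (λ Y → ¬ Model Y (Below F r)) (∪-identityˡ X) ¬Mr
  where
  open Forest F
  open Models G S R F
  open Peeling (PathSweep.sweep G S R F D width≤)
  everything : Model ⊥ (Trees roots) → Model ⊥ (λ _ → ⊤)
  everything M = restrict M id λ {v} _ → let r , root , b = below-root v in r , ∈-roots⁺ root , b
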